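{- Let $D>0$ be a square-free integer with $D\equiv 3\pmod 4$, let $F=\mathbb{Q}(\sqrt D)$ and $B=\left(\frac{ -1,-1}{F}\right)$. Then $\mathcal{O}=\mathbb{Z}[\sqrt D]\,1+\mathbb{Z}[\sqrt D]\,i+\mathbb{Z}[\sqrt D]\,\frac{\sqrt D\, i+j}{2}+\mathbb{Z}[\sqrt D]\,\frac{\sqrt D+k}{2}$ is a maximal order in $B$.
   Context: $B=\left(\frac{ -1,-1}{F}\right)$ is the quaternion algebra over $F$ with $F$-basis $1,i,j,k$, $i^2=j^2=-1$, $ij=-ji=k$. An order of $B$ is a subring of $B$ containing $1$ which is a finitely generated $\mathbb{Z}_F$-module spanning $B$ over $F$ (here $\mathbb{Z}_F=\mathbb{Z}[\sqrt D]$); a maximal order is an order not properly contained in another order. -}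

module Defs where

open import Data.Nat using (ℕ; suc) renaming (_*_ to _*ℕ_)
open import Data.Nat.Divisibility using (_∣_)
open import Data.Integer using (ℤ; +_)
open import Data.Rational using (ℚ; _/_; 0ℚ; 1ℚ; ½) renaming (_+_ to _+q_; _*_ to _*q_; -_ to -q_)
open import Data.Vec using (Vec; []; _∷_)
open import Data.Vec.Relation.Unary.All using (All)
open import Data.Product using (Σ; _×_; ∃)
open import Relation.Binary.PropositionalEquality using (_≡_)

SquareFree : ℕ → Set
SquareFree D = ∀ (n : ℕ) → (n *ℕ n) ∣ D → n ≡ 1

module Quat (D : ℕ) where

  Dq : ℚ
  Dq = (+ D) / 1

  record F : Set where
    constructor _+√D_
    field
      re : ℚ
      ir : ℚ
  open F public

  _+F_ : F → F → F
  (a +√D b) +F (c +√D d) = (a +q c) +√D (b +q d)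

  _*F_ : F → F → F
  (a +√D b) *F (c +√D d) = ((a *q c) +q (Dq *q (b *q d))) +√D ((a *q d) +q (b *q c))

  -F_ : F → F
  -F (a +√D b) = (-q a) +√D (-q b)

  0F 1F : F
  0F = 0ℚ +√D 0ℚ
  1F = 1ℚ +√D 0ℚ

  record ZF : Set where
    constructor _+√D'_
    field
      zre : ℤ
      zir : ℤ

  ι : ZF → F
  ι (a +√D' b) = (a / 1) +√D (b / 1)

  record B : Set where
    constructor quat
    field
      c1 ci cj ck : F

  _+B_ : B → B → B
  quat a b c d +B quat a' b' c' d' = quat (a +F a') (b +F b') (c +F c') (d +F d')

  -B_ : B → B
  -B quat a b c d = quat (-F a) (-F b) (-F c) (-F d)

  -- i² = j² = -1, ij = -ji = k
  _*B_ : B → B → B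
  quat a1 b1 c1 d1 *B quat a2 b2 c2 d2 = quat
    ((((a1 *F a2) +F (-F (b1 *F b2))) +F (-F (c1 *F c2))) +F (-F (d1 *F d2)))
    ((((a1 *F b2) +F (b1 *F a2)) +F (c1 *F d2)) +F (-F (d1 *F c2)))
    ((((a1 *F c2) +F (-F (b1 *F d2))) +F (c1 *F a2)) +F (d1 *F b2))
    ((((a1 *F d2) +F (b1 *F c2)) +F (-F (c1 *F b2))) +F (d1 *F a2))

  _·_ : F → B → B
  s · quat a b c d = quat (s *F a) (s *F b) (s *F c) (s *F d)

  0B 1B 𝐢 𝐣 𝐤 : B
  0B = quat 0F 0F 0F 0F
  1B = quat 1F 0F 0F 0F
  𝐢  = quat 0F 1F 0F 0F
  𝐣  = quat 0F 0F 1F 0F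
  𝐤  = quat 0F 0F 0F 1F

  √D : F
  √D = 0ℚ +√D 1ℚ

  ½F : F
  ½F = ½ +√D 0ℚ

  combF : ∀ {n} → Vec F n → Vec B n → B
  combF [] [] = 0B
  combF (s ∷ ss) (x ∷ xs) = (s · x) +B combF ss xs

  combZ : ∀ {n} → Vec ZF n → Vec B n → B
  combZ [] [] = 0B
  combZ (s ∷ ss) (x ∷ xs) = (ι s · x) +B combZ ss xs

  Subset : Set₁
  Subset = B → Set

  _⊆_ : Subset → Subset → Set
  O ⊆ O' = ∀ x → O x → O' x

  record IsOrder (O : Subset) : Set where
    field
      one∈   : O 1B
      +-closed : ∀ x y → O x → O y → O (x +B y)
      neg-closed : ∀ x → O x → O (-B x)
      *-closed : ∀ x y → O x → O y → O (x *B y)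
      ZF-closed : ∀ (r : ZF) x → O x → O (ι r · x)
      finGen : Σ ℕ λ n → Σ (Vec B n) λ gs →
                 All O gs × (∀ x → O x → Σ (Vec ZF n) λ cs → x ≡ combZ cs gs)
      spans  : ∀ (y : B) → Σ ℕ λ n → Σ (Vec F n) λ cs → Σ (Vec B n) λ xs →
                 All O xs × (y ≡ combF cs xs)

  record IsMaximalOrder (O : Subset) : Set₁ where
    field
      isOrder : IsOrder O
      maximal : ∀ (O' : Subset) → IsOrder O' → O ⊆ O' → O' ⊆ O

  e₃ e₄ : B
  e₃ = ½F · ((√D · 𝐢) +B 𝐣)
  e₄ = ½F · ((√D · 1B) +B 𝐤)

  𝒪 : Subset
  𝒪 x = Σ ZF λ a → Σ ZF λ b → Σ ZF λ c → Σ ZF λ d →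
          x ≡ (((ι a · 1B) +B (ι b · 𝐢)) +B (ι c · e₃)) +B (ι d · e₄)

{-# OPTIONS --safe #-}
-- 𝒪 is closed under multiplication because i, e₃ and e₄ times the basis 1, i, e₃, e₄ are
-- again Z[√D]-combinations of it; the only coefficient that is not visibly integral is
-- (D + 1)/4, an integer since D ≡ 3 (mod 4).
--
-- For maximality let O ⊇ 𝒪 be an order. Being finitely generated, O has bounded
-- denominators. As 2x̄ = −(x + ixi + jxj + kxk) lies in O with x, so does
-- 2 nrd(y)ᵐ = yᵐ · 2ȳᵐ for y ∈ O, hence all powers of nrd(y) have bounded denominators.
-- Such an element h of ℚ(√D) lies in Z[√D]: the norms of h and h + 1 are integers, hence
-- so is 2 Re h, then D (2 Im h)² and, D being squarefree, 2 Im h; finally D ≡ 3 (mod 4)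
-- makes Re h and Im h integers. So nrd and trd = nrd(· + 1) − nrd − 1 are Z[√D]-valued on
-- O, and the coordinates of x ∈ O in the basis of 𝒪 are Z[√D]-combinations of trd(xu),
-- u ∈ {1, i, j, k, e₃, e₄}; thus x ∈ 𝒪.
module Submission where

open import Defs
open import Data.Nat as ℕ using (ℕ; zero; suc; _≤_; _<_; _%_; z≤n; s≤s; NonZero)
import Data.Nat.Properties as ℕP
import Data.Nat.DivMod as ℕDivMod
open import Data.Nat.Divisibility using (_∣_; divides; ∣-trans; ∣1⇒≡1; ∣⇒≤)
open import Data.Nat.Coprimality as Coprime using (Coprime; coprime-divisor)
open import Data.Integer as ℤ using (ℤ; +_; ∣_∣)
import Data.Integer.Properties as ℤP
open import Data.Integer.DivMod using (_/ℕ_; _%ℕ_; n%ℕd<d; a≡a%ℕn+[a/ℕn]*n)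
import Data.Integer.Tactic.RingSolver as ℤSolver
open import Data.Rational as ℚ using (ℚ; mkℚ; 0ℚ; 1ℚ; ½; ↧ₙ_; _/_; _+_; _*_; -_; _-_; toℚᵘ)
import Data.Rational.Properties as ℚP
open import Data.Rational.Unnormalised using (mkℚᵘ; *≡*; _≃_)
import Data.Rational.Unnormalised.Properties as ℚᵘP
open import Data.Vec as Vec using (Vec; []; _∷_; allFin)
open import Data.Vec.N-ary using (N-ary; _$ⁿ_)
open import Data.Vec.Relation.Unary.All as All using (All; []; _∷_)
open import Data.Product using (Σ; _×_; _,_; proj₁; proj₂)
open import Data.Maybe using (Maybe; just; nothing)
open import Data.Empty using (⊥-elim)
open import Function using (_$_)
open import Level using (0ℓ)
open import Relation.Nullary using (yes; no)
open import Relation.Binary.PropositionalEquality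
open import Algebra.Bundles using (CommutativeRing; Semiring)
open import Algebra.Structures using (IsCommutativeRing)
open import Algebra.Definitions.RawSemiring ℚ.+-*-rawSemiring using () renaming (_^_ to _^ℚ_)
open import Algebra.Solver.Ring.AlmostCommutativeRing using (fromCommutativeRing; _-Raw-AlmostCommutative⟶_)
import Algebra.Solver.Ring as RingSolver
import Tactic.RingSolver as ℚSolver
import Tactic.RingSolver.Core.AlmostCommutativeRing as ℚACR

ℚ-ring : ℚACR.AlmostCommutativeRing 0ℓ 0ℓ
ℚ-ring = ℚACR.fromCommutativeRing ℚP.+-*-commutativeRing λ { (mkℚ (+ 0) 0 _) → just refl ; _ → nothing }

ℤ→ℚ : ℤ → ℚ
ℤ→ℚ z = z / 1

private
  ℤ→ℚᵘ : ∀ z → toℚᵘ (ℤ→ℚ z) ≃ mkℚᵘ z 0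
  ℤ→ℚᵘ z = ℚP.toℚᵘ-fromℚᵘ (mkℚᵘ z 0)

  ℤ→ℚ-viaᵘ : ∀ z {r} → toℚᵘ r ≃ mkℚᵘ z 0 → ℤ→ℚ z ≡ r
  ℤ→ℚ-viaᵘ z r≃z = ℚP.toℚᵘ-injective (ℚᵘP.≃-trans (ℤ→ℚᵘ z) (ℚᵘP.≃-sym r≃z))

ℤ→ℚ-+ : ∀ z w → ℤ→ℚ (z ℤ.+ w) ≡ ℤ→ℚ z + ℤ→ℚ w
ℤ→ℚ-+ z w = ℤ→ℚ-viaᵘ (z ℤ.+ w) (ℚᵘP.≃-trans (ℚP.toℚᵘ-homo-+ (ℤ→ℚ z) (ℤ→ℚ w))
  (ℚᵘP.≃-trans (ℚᵘP.+-cong (ℤ→ℚᵘ z) (ℤ→ℚᵘ w)) (*≡* (cross-multiply z w))))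
  where
  cross-multiply : ∀ z w → ((z ℤ.* + 1) ℤ.+ (w ℤ.* + 1)) ℤ.* + 1 ≡ (z ℤ.+ w) ℤ.* + 1
  cross-multiply = ℤSolver.solve-∀

ℤ→ℚ-* : ∀ z w → ℤ→ℚ (z ℤ.* w) ≡ ℤ→ℚ z * ℤ→ℚ w
ℤ→ℚ-* z w = ℤ→ℚ-viaᵘ (z ℤ.* w)
  (ℚᵘP.≃-trans (ℚP.toℚᵘ-homo-* (ℤ→ℚ z) (ℤ→ℚ w)) (ℚᵘP.*-cong (ℤ→ℚᵘ z) (ℤ→ℚᵘ w)))

ℤ→ℚ-neg : ∀ z → ℤ→ℚ (ℤ.- z) ≡ - ℤ→ℚ z
ℤ→ℚ-neg z = ℤ→ℚ-viaᵘ (ℤ.- z) (ℚᵘP.≃-trans (ℚP.toℚᵘ-homo‿- (ℤ→ℚ z)) (ℚᵘP.-‿cong (ℤ→ℚᵘ z)))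

ℤ→ℚ-pos-* : ∀ m n → ℤ→ℚ (+ (m ℕ.* n)) ≡ ℤ→ℚ (+ m) * ℤ→ℚ (+ n)
ℤ→ℚ-pos-* m n = trans (cong ℤ→ℚ (ℤP.pos-* m n)) (ℤ→ℚ-* (+ m) (+ n))

ℤ→ℚ-injective : ∀ {z w} → ℤ→ℚ z ≡ ℤ→ℚ w → z ≡ w
ℤ→ℚ-injective {z} {w} eq
  with ℚᵘP.≃-trans (ℚᵘP.≃-sym (ℤ→ℚᵘ z)) (ℚᵘP.≃-trans (ℚᵘP.≃-reflexive (cong toℚᵘ eq)) (ℤ→ℚᵘ w))
... | *≡* z*1≡w*1 = trans (sym (ℤP.*-identityʳ z)) (trans z*1≡w*1 (ℤP.*-identityʳ w))

IsInteger : ℚ → Set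
IsInteger r = Σ ℤ λ z → ℤ→ℚ z ≡ r

IsInteger-+ : ∀ {r s} → IsInteger r → IsInteger s → IsInteger (r + s)
IsInteger-+ (z , refl) (w , refl) = z ℤ.+ w , ℤ→ℚ-+ z w

IsInteger-* : ∀ {r s} → IsInteger r → IsInteger s → IsInteger (r * s)
IsInteger-* (z , refl) (w , refl) = z ℤ.* w , ℤ→ℚ-* z w

IsInteger-neg : ∀ {r} → IsInteger r → IsInteger (- r)
IsInteger-neg (z , refl) = ℤ.- z , ℤ→ℚ-neg z

IsInteger-- : ∀ {r s} → IsInteger r → IsInteger s → IsInteger (r - s)
IsInteger-- r∈ℤ s∈ℤ = IsInteger-+ r∈ℤ (IsInteger-neg s∈ℤ)

IsInteger-half : ∀ {u} w → ℤ→ℚ (w ℤ.* + 2) ≡ u + u → IsInteger u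
IsInteger-half {u} w 2w≡u+u = w , (begin
  ℤ→ℚ w                     ≡⟨ half-of-double (ℤ→ℚ w) ⟨
  ½ * (ℤ→ℚ w * ℤ→ℚ (+ 2))   ≡⟨ cong (½ *_) (trans (sym (ℤ→ℚ-* w (+ 2))) 2w≡u+u) ⟩
  ½ * (u + u)               ≡⟨ half-of-sum u ⟩
  u                         ∎)
  where
  open ≡-Reasoning
  half-of-double : ∀ w → ½ * (w * ℤ→ℚ (+ 2)) ≡ w
  half-of-double = ℚSolver.solve-∀ ℚ-ring
  half-of-sum : ∀ u → ½ * (u + u) ≡ u
  half-of-sum = ℚSolver.solve-∀ ℚ-ring

denominator≤1⇒IsInteger : ∀ q → ↧ₙ q ≤ 1 → IsInteger q
denominator≤1⇒IsInteger q@(mkℚ p zero _) _        = p , ℚP.↥p/↧p≡p q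
denominator≤1⇒IsInteger (mkℚ p (suc _) _) (s≤s ())

private
  suc-pred : ∀ n .{{_ : NonZero n}} → suc (ℕ.pred n) ≡ n
  suc-pred (suc n) = refl

  toℚᵘ-^ : ∀ p d-1 .(c : Coprime ∣ p ∣ (suc d-1)) m →
           toℚᵘ (mkℚ p d-1 c ^ℚ m) ≃ mkℚᵘ (p ℤ.^ m) (ℕ.pred (suc d-1 ℕ.^ m))
  toℚᵘ-^ p d-1 c zero    = ℚᵘP.≃-refl
  toℚᵘ-^ p d-1 c (suc m) = ℚᵘP.≃-trans (ℚP.toℚᵘ-homo-* (mkℚ p d-1 c) (mkℚ p d-1 c ^ℚ m))
    (ℚᵘP.≃-trans (ℚᵘP.*-cong (ℚᵘP.≃-refl {mkℚᵘ p d-1}) (toℚᵘ-^ p d-1 c m))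
      (*≡* (cong (λ e → (p ℤ.* p ℤ.^ m) ℤ.* + e) denominators)))
    where
    d = suc d-1
    instance
      dᵐ≢0 : NonZero (d ℕ.^ m)
      dᵐ≢0 = ℕP.m^n≢0 d m
      d¹⁺ᵐ≢0 : NonZero (d ℕ.^ suc m)
      d¹⁺ᵐ≢0 = ℕP.m^n≢0 d (suc m)
    denominators : suc (ℕ.pred (d ℕ.^ suc m)) ≡ d ℕ.* suc (ℕ.pred (d ℕ.^ m))
    denominators = trans (suc-pred (d ℕ.^ suc m)) (cong (d ℕ.*_) (sym (suc-pred (d ℕ.^ m))))

  ∣^∣ : ∀ p m → ∣ p ℤ.^ m ∣ ≡ ∣ p ∣ ℕ.^ m
  ∣^∣ p zero    = refl
  ∣^∣ p (suc m) = trans (ℤP.abs-* p (p ℤ.^ m)) (cong (∣ p ∣ ℕ.*_) (∣^∣ p m))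

  coprime-* : ∀ {a b c} → Coprime a c → Coprime b c → Coprime (a ℕ.* b) c
  coprime-* a⊥c b⊥c (i∣ab , i∣c) = b⊥c (coprime-divisor (λ (j∣i , j∣a) → a⊥c (j∣a , ∣-trans j∣i i∣c)) i∣ab , i∣c)

  coprime-^ˡ : ∀ {a c} m → Coprime a c → Coprime (a ℕ.^ m) c
  coprime-^ˡ zero    a⊥c (j∣1 , _) = ∣1⇒≡1 j∣1
  coprime-^ˡ (suc m) a⊥c           = coprime-* a⊥c (coprime-^ˡ m a⊥c)

  coprime-^ : ∀ {a c} m → Coprime a c → Coprime (a ℕ.^ m) (c ℕ.^ m)
  coprime-^ m a⊥c = Coprime.sym (coprime-^ˡ m (Coprime.sym (coprime-^ˡ m a⊥c)))

denominator-^-∣ : ∀ M q m → IsInteger (ℤ→ℚ (+ M) * q ^ℚ m) → ↧ₙ q ℕ.^ m ∣ M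
denominator-^-∣ M q@(mkℚ p d-1 c) m (z , z≡Mqᵐ) =
  coprime-divisor (coprime-^ m (Coprime.sym (Coprime.recompute c)))
    (divides ∣ z ∣ (trans (ℕP.*-comm (∣ p ∣ ℕ.^ m) M) M∣p∣ᵐ≡∣z∣dᵐ))
  where
  d = suc d-1
  instance
    dᵐ≢0 : NonZero (d ℕ.^ m)
    dᵐ≢0 = ℕP.m^n≢0 d m
  cross : z ℤ.* + (suc (ℕ.pred (d ℕ.^ m) ℕ.+ 0)) ≡ (+ M ℤ.* p ℤ.^ m) ℤ.* + 1
  cross with ℚᵘP.≃-trans (ℚᵘP.≃-sym (ℤ→ℚᵘ z)) (ℚᵘP.≃-trans (ℚᵘP.≃-reflexive (cong toℚᵘ z≡Mqᵐ))
               (ℚᵘP.≃-trans (ℚP.toℚᵘ-homo-* (ℤ→ℚ (+ M)) (q ^ℚ m)) (ℚᵘP.*-cong (ℤ→ℚᵘ (+ M)) (toℚᵘ-^ p d-1 c m))))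
  ... | *≡* eq = eq
  M∣p∣ᵐ≡∣z∣dᵐ : M ℕ.* ∣ p ∣ ℕ.^ m ≡ ∣ z ∣ ℕ.* d ℕ.^ m
  M∣p∣ᵐ≡∣z∣dᵐ = begin
    M ℕ.* ∣ p ∣ ℕ.^ m                           ≡⟨ cong (M ℕ.*_) (∣^∣ p m) ⟨
    M ℕ.* ∣ p ℤ.^ m ∣                           ≡⟨ ℤP.abs-* (+ M) (p ℤ.^ m) ⟨
    ∣ + M ℤ.* p ℤ.^ m ∣                         ≡⟨ cong ∣_∣ (ℤP.*-identityʳ (+ M ℤ.* p ℤ.^ m)) ⟨
    ∣ (+ M ℤ.* p ℤ.^ m) ℤ.* + 1 ∣               ≡⟨ cong ∣_∣ cross ⟨
    ∣ z ℤ.* + (suc (ℕ.pred (d ℕ.^ m) ℕ.+ 0)) ∣   ≡⟨ ℤP.abs-* z _ ⟩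
    ∣ z ∣ ℕ.* suc (ℕ.pred (d ℕ.^ m) ℕ.+ 0)       ≡⟨ cong (λ e → ∣ z ∣ ℕ.* suc e) (ℕP.+-identityʳ _) ⟩
    ∣ z ∣ ℕ.* suc (ℕ.pred (d ℕ.^ m))             ≡⟨ cong (∣ z ∣ ℕ.*_) (suc-pred (d ℕ.^ m)) ⟩
    ∣ z ∣ ℕ.* d ℕ.^ m                           ∎
    where open ≡-Reasoning

private
  n<dⁿ : ∀ d n → 2 ≤ d → n < d ℕ.^ n
  n<dⁿ d zero    _   = s≤s z≤n
  n<dⁿ d (suc n) 2≤d = begin-strict
    suc n                 <⟨ s≤s (n<dⁿ d n 2≤d) ⟩
    suc (d ℕ.^ n)         ≡⟨ ℕP.+-comm 1 (d ℕ.^ n) ⟩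
    d ℕ.^ n ℕ.+ 1         ≤⟨ ℕP.+-monoʳ-≤ (d ℕ.^ n) (ℕP.≤-trans (s≤s z≤n) (n<dⁿ d n 2≤d)) ⟩
    d ℕ.^ n ℕ.+ d ℕ.^ n   ≡⟨ cong (d ℕ.^ n ℕ.+_) (ℕP.+-identityʳ _) ⟨
    2 ℕ.* d ℕ.^ n         ≤⟨ ℕP.*-monoˡ-≤ (d ℕ.^ n) 2≤d ⟩
    d ℕ.* d ℕ.^ n         ∎
    where open ℕP.≤-Reasoning

  ^≤⇒≤1 : ∀ d n → d ℕ.^ n ≤ n → d ≤ 1
  ^≤⇒≤1 zero          _ _    = z≤n
  ^≤⇒≤1 (suc zero)    _ _    = ℕP.≤-refl
  ^≤⇒≤1 (suc (suc d)) n dⁿ≤n = ⊥-elim (ℕP.<⇒≱ (n<dⁿ (suc (suc d)) n (s≤s (s≤s z≤n))) dⁿ≤n)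

bounded-powers⇒IsInteger : ∀ M → 0 < M → ∀ q → (∀ m → IsInteger (ℤ→ℚ (+ M) * q ^ℚ m)) → IsInteger q
bounded-powers⇒IsInteger M 0<M q Mqᵐ∈ℤ = denominator≤1⇒IsInteger q (^≤⇒≤1 (↧ₙ q) M dᴹ≤M)
  where
  dᴹ≤M : ↧ₙ q ℕ.^ M ≤ M
  dᴹ≤M = ∣⇒≤ ⦃ ℕ.>-nonZero 0<M ⦄ (denominator-^-∣ M q M (Mqᵐ∈ℤ M))

squarefree⇒IsInteger : ∀ D → SquareFree D → ∀ w → IsInteger (ℤ→ℚ (+ D) * (w * w)) → IsInteger w
squarefree⇒IsInteger D sf w Dw²∈ℤ = denominator≤1⇒IsInteger w (ℕP.≤-reflexive (sf (↧ₙ w) d²∣D))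
  where
  d²∣D : ↧ₙ w ℕ.* ↧ₙ w ∣ D
  d²∣D = subst (_∣ D) (cong (↧ₙ w ℕ.*_) (ℕP.*-identityʳ (↧ₙ w)))
    (denominator-^-∣ D w 2 (subst IsInteger (cong (λ v → ℤ→ℚ (+ D) * (w * v)) (sym (ℚP.*-identityʳ w))) Dw²∈ℤ))

-- A congruence modulo 4

private
  divide-by-2 : ∀ X → Σ ℕ λ r → r ≤ 1 × X ≡ + r ℤ.+ (X /ℕ 2) ℤ.* + 2
  divide-by-2 X with X %ℕ 2 | n%ℕd<d X 2 | a≡a%ℕn+[a/ℕn]*n X 2
  ... | r | s≤s r≤1 | X≡ = r , r≤1 , X≡

  4∤ : ∀ {c} u → ∣ c ∣ ℕ.% 4 ≢ 0 → c ≢ + 4 ℤ.* u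
  4∤ u ∣c∣%4≢0 refl =
    ∣c∣%4≢0 (trans (cong (ℕ._% 4) (trans (ℤP.abs-* (+ 4) u) (ℕP.*-comm 4 ∣ u ∣))) (ℕDivMod.m*n%n≡0 ∣ u ∣ 4))

X²-DY²≡0[mod4]⇒even : ∀ k X Y t → X ℤ.* X ℤ.- (+ 3 ℤ.+ + k ℤ.* + 4) ℤ.* (Y ℤ.* Y) ≡ + 4 ℤ.* t →
                      Σ ℤ λ X′ → Σ ℤ λ Y′ → X ≡ X′ ℤ.* + 2 × Y ≡ Y′ ℤ.* + 2
X²-DY²≡0[mod4]⇒even k X Y t X²-DY²≡4t with divide-by-2 X | divide-by-2 Y
... | r , r≤1 , X≡ | s , s≤1 , Y≡ = X′ , Y′ , even r≤1 s≤1 X≡ Y≡ r²-3s²≡4u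
  where
  X′ = X /ℕ 2
  Y′ = Y /ℕ 2
  W : ℤ
  W = ((+ r ℤ.* X′ ℤ.+ X′ ℤ.* X′) ℤ.- + k ℤ.* (+ s ℤ.* + s)) ℤ.- (+ 3 ℤ.+ + k ℤ.* + 4) ℤ.* (+ s ℤ.* Y′ ℤ.+ Y′ ℤ.* Y′)
  expand : ∀ r s X′ Y′ k → r ℤ.* r ℤ.- + 3 ℤ.* (s ℤ.* s) ≡
    ((r ℤ.+ X′ ℤ.* + 2) ℤ.* (r ℤ.+ X′ ℤ.* + 2) ℤ.- (+ 3 ℤ.+ k ℤ.* + 4) ℤ.* ((s ℤ.+ Y′ ℤ.* + 2) ℤ.* (s ℤ.+ Y′ ℤ.* + 2)))
      ℤ.- + 4 ℤ.* (((r ℤ.* X′ ℤ.+ X′ ℤ.* X′) ℤ.- k ℤ.* (s ℤ.* s)) ℤ.- (+ 3 ℤ.+ k ℤ.* + 4) ℤ.* (s ℤ.* Y′ ℤ.+ Y′ ℤ.* Y′))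
  expand = ℤSolver.solve-∀
  factor-4 : ∀ t W → + 4 ℤ.* t ℤ.- + 4 ℤ.* W ≡ + 4 ℤ.* (t ℤ.- W)
  factor-4 = ℤSolver.solve-∀
  r²-3s²≡4u : + r ℤ.* + r ℤ.- + 3 ℤ.* (+ s ℤ.* + s) ≡ + 4 ℤ.* (t ℤ.- W)
  r²-3s²≡4u = trans (expand (+ r) (+ s) X′ Y′ (+ k)) (trans (cong (ℤ._- + 4 ℤ.* W)
    (subst₂ (λ a b → a ℤ.* a ℤ.- (+ 3 ℤ.+ + k ℤ.* + 4) ℤ.* (b ℤ.* b) ≡ + 4 ℤ.* t) X≡ Y≡ X²-DY²≡4t)) (factor-4 t W))
  even : ∀ {r s u} → r ≤ 1 → s ≤ 1 → X ≡ + r ℤ.+ X′ ℤ.* + 2 → Y ≡ + s ℤ.+ Y′ ℤ.* + 2 →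
         + r ℤ.* + r ℤ.- + 3 ℤ.* (+ s ℤ.* + s) ≡ + 4 ℤ.* u → X ≡ X′ ℤ.* + 2 × Y ≡ Y′ ℤ.* + 2
  even         z≤n       z≤n       X≡ Y≡ _  = trans X≡ (ℤP.+-identityˡ _) , trans Y≡ (ℤP.+-identityˡ _)
  even {u = u} z≤n       (s≤s z≤n) _  _  eq = ⊥-elim (4∤ u (λ ()) eq)
  even {u = u} (s≤s z≤n) z≤n       _  _  eq = ⊥-elim (4∤ u (λ ()) eq)
  even {u = u} (s≤s z≤n) (s≤s z≤n) _  _  eq = ⊥-elim (4∤ u (λ ()) eq)

-- A record rather than a synonym, so that N and r can be inferred from it.
record _∙_∈ℤ (N : ℕ) (r : ℚ) : Set where
  constructor scaled
  field integer : IsInteger (ℤ→ℚ (+ N) * r)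

infix 4 _∙_∈ℤ

∈ℤ-+ : ∀ {N r s} → N ∙ r ∈ℤ → N ∙ s ∈ℤ → N ∙ r + s ∈ℤ
∈ℤ-+ {N} {r} {s} (scaled Nr∈ℤ) (scaled Ns∈ℤ) =
  scaled $ subst IsInteger (sym (ℚP.*-distribˡ-+ (ℤ→ℚ (+ N)) r s)) (IsInteger-+ Nr∈ℤ Ns∈ℤ)

∈ℤ-* : ∀ {N z r} → IsInteger z → N ∙ r ∈ℤ → N ∙ z * r ∈ℤ
∈ℤ-* {N} {z} {r} z∈ℤ (scaled Nr∈ℤ) = scaled $ subst IsInteger (commute z (ℤ→ℚ (+ N)) r) (IsInteger-* z∈ℤ Nr∈ℤ)
  where
  commute : ∀ z n r → z * (n * r) ≡ n * (z * r)
  commute = ℚSolver.solve-∀ ℚ-ring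

∈ℤ-0 : ∀ {N} → N ∙ 0ℚ ∈ℤ
∈ℤ-0 {N} = scaled $ subst IsInteger (sym (ℚP.*-zeroʳ (ℤ→ℚ (+ N)))) (+ 0 , refl)

∈ℤ-*ˡ : ∀ M {N r} → N ∙ r ∈ℤ → M ℕ.* N ∙ r ∈ℤ
∈ℤ-*ˡ M {N} {r} (scaled Nr∈ℤ) = scaled $ subst IsInteger
  (trans (sym (ℚP.*-assoc (ℤ→ℚ (+ M)) (ℤ→ℚ (+ N)) r)) (cong (_* r) (sym (ℤ→ℚ-pos-* M N))))
  (IsInteger-* (+ M , refl) Nr∈ℤ)

∈ℤ-double : ∀ {N r} → N ∙ r + r ∈ℤ → 2 ℕ.* N ∙ r ∈ℤ
∈ℤ-double {N} {r} (scaled N[r+r]∈ℤ) = scaled $ subst IsInteger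
  (trans (double (ℤ→ℚ (+ N)) r) (cong (_* r) (sym (ℤ→ℚ-pos-* 2 N)))) N[r+r]∈ℤ
  where
  double : ∀ n r → n * (r + r) ≡ (ℤ→ℚ (+ 2) * n) * r
  double = ℚSolver.solve-∀ ℚ-ring

∈ℤ-denominator : ∀ r → ↧ₙ r ∙ r ∈ℤ
∈ℤ-denominator r@(mkℚ p d-1 _) = scaled $ p , ℤ→ℚ-viaᵘ p
  (ℚᵘP.≃-trans (ℚP.toℚᵘ-homo-* (ℤ→ℚ (+ suc d-1)) r)
    (ℚᵘP.≃-trans (ℚᵘP.*-cong (ℤ→ℚᵘ (+ suc d-1)) (ℚᵘP.≃-refl {mkℚᵘ p d-1}))
      (*≡* (trans (swap (+ suc d-1) p) (cong (λ e → p ℤ.* + suc e) (sym (ℕP.+-identityʳ d-1)))))))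
  where
  swap : ∀ d p → (d ℤ.* p) ℤ.* + 1 ≡ p ℤ.* d
  swap = ℤSolver.solve-∀

HasBound : ∀ {A : Set} → (ℕ → A → Set) → A → Set
HasBound P a = Σ ℕ λ N → 0 < N × P N a

common-bound : ∀ {A : Set} (P : ℕ → A → Set) → (∀ M {N a} → P N a → P (M ℕ.* N) a) →
               (∀ a → HasBound P a) → ∀ {n} (as : Vec A n) → HasBound (λ N → All (P N)) as
common-bound P scale bound []       = 1 , s≤s z≤n , []
common-bound P scale bound (a ∷ as) with bound a | common-bound P scale bound as
... | N , 0<N , Pa | M , 0<M , Pas =
  N ℕ.* M , ℕP.*-mono-< 0<N 0<M , subst (λ K → P K a) (ℕP.*-comm M N) (scale M Pa) ∷ All.map (scale N) Pas

module _ (D : ℕ) where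
  open Quat D
  open B using (c1; ci; cj; ck)

  -- F = ℚ(√D) as a commutative ring, and identities in F and B by normalisation

  +F-assoc : ∀ x y z → (x +F y) +F z ≡ x +F (y +F z)
  +F-assoc (a +√D b) (c +√D e) (f +√D g) = cong₂ _+√D_ (ℚP.+-assoc a c f) (ℚP.+-assoc b e g)

  +F-comm : ∀ x y → x +F y ≡ y +F x
  +F-comm (a +√D b) (c +√D e) = cong₂ _+√D_ (ℚP.+-comm a c) (ℚP.+-comm b e)

  +F-identityˡ : ∀ x → 0F +F x ≡ x
  +F-identityˡ (a +√D b) = cong₂ _+√D_ (ℚP.+-identityˡ a) (ℚP.+-identityˡ b)

  +F-identityʳ : ∀ x → x +F 0F ≡ x
  +F-identityʳ (a +√D b) = cong₂ _+√D_ (ℚP.+-identityʳ a) (ℚP.+-identityʳ b)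

  +F-inverseˡ : ∀ x → (-F x) +F x ≡ 0F
  +F-inverseˡ (a +√D b) = cong₂ _+√D_ (ℚP.+-inverseˡ a) (ℚP.+-inverseˡ b)

  +F-inverseʳ : ∀ x → x +F (-F x) ≡ 0F
  +F-inverseʳ (a +√D b) = cong₂ _+√D_ (ℚP.+-inverseʳ a) (ℚP.+-inverseʳ b)

  *F-assoc : ∀ x y z → (x *F y) *F z ≡ x *F (y *F z)
  *F-assoc (a +√D b) (c +√D e) (f +√D g) = cong₂ _+√D_ (re-assoc Dq a b c e f g) (ir-assoc Dq a b c e f g)
    where
    re-assoc : ∀ d a b c e f g →
      (((a * c) + (d * (b * e))) * f) + (d * (((a * e) + (b * c)) * g))
        ≡ (a * ((c * f) + (d * (e * g)))) + (d * (b * ((c * g) + (e * f))))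
    re-assoc = ℚSolver.solve-∀ ℚ-ring
    ir-assoc : ∀ d a b c e f g →
      (((a * c) + (d * (b * e))) * g) + (((a * e) + (b * c)) * f)
        ≡ (a * ((c * g) + (e * f))) + (b * ((c * f) + (d * (e * g))))
    ir-assoc = ℚSolver.solve-∀ ℚ-ring

  *F-comm : ∀ x y → x *F y ≡ y *F x
  *F-comm (a +√D b) (c +√D e) = cong₂ _+√D_ (re-comm Dq a b c e) (ir-comm a b c e)
    where
    re-comm : ∀ d a b c e → (a * c) + (d * (b * e)) ≡ (c * a) + (d * (e * b))
    re-comm = ℚSolver.solve-∀ ℚ-ring
    ir-comm : ∀ a b c e → (a * e) + (b * c) ≡ (c * b) + (e * a)
    ir-comm = ℚSolver.solve-∀ ℚ-ring

  *F-identityˡ : ∀ x → 1F *F x ≡ x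
  *F-identityˡ (a +√D b) = cong₂ _+√D_ (re-identity Dq a b) (ir-identity a b)
    where
    re-identity : ∀ d a b → (1ℚ * a) + (d * (0ℚ * b)) ≡ a
    re-identity = ℚSolver.solve-∀ ℚ-ring
    ir-identity : ∀ a b → (1ℚ * b) + (0ℚ * a) ≡ b
    ir-identity = ℚSolver.solve-∀ ℚ-ring

  *F-identityʳ : ∀ x → x *F 1F ≡ x
  *F-identityʳ x = trans (*F-comm x 1F) (*F-identityˡ x)

  *F-distribˡ : ∀ x y z → x *F (y +F z) ≡ (x *F y) +F (x *F z)
  *F-distribˡ (a +√D b) (c +√D e) (f +√D g) = cong₂ _+√D_ (re-distrib Dq a b c e f g) (ir-distrib a b c e f g)
    where
    re-distrib : ∀ d a b c e f g →
      (a * (c + f)) + (d * (b * (e + g))) ≡ ((a * c) + (d * (b * e))) + ((a * f) + (d * (b * g)))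
    re-distrib = ℚSolver.solve-∀ ℚ-ring
    ir-distrib : ∀ a b c e f g →
      (a * (e + g)) + (b * (c + f)) ≡ ((a * e) + (b * c)) + ((a * g) + (b * f))
    ir-distrib = ℚSolver.solve-∀ ℚ-ring

  *F-distribʳ : ∀ x y z → (y +F z) *F x ≡ (y *F x) +F (z *F x)
  *F-distribʳ x y z = begin
    (y +F z) *F x             ≡⟨ *F-comm (y +F z) x ⟩
    x *F (y +F z)             ≡⟨ *F-distribˡ x y z ⟩
    (x *F y) +F (x *F z)      ≡⟨ cong₂ _+F_ (*F-comm x y) (*F-comm x z) ⟩
    (y *F x) +F (z *F x)      ∎
    where open ≡-Reasoning

  F-isCommutativeRing : IsCommutativeRing _≡_ _+F_ _*F_ -F_ 0F 1F
  F-isCommutativeRing = record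
    { isRing = record
      { +-isAbelianGroup = record
        { isGroup = record
          { isMonoid = record
            { isSemigroup = record
              { isMagma = record { isEquivalence = isEquivalence ; ∙-cong = cong₂ _+F_ }
              ; assoc = +F-assoc }
            ; identity = +F-identityˡ , +F-identityʳ }
          ; inverse = +F-inverseˡ , +F-inverseʳ
          ; ⁻¹-cong = cong -F_ }
        ; comm = +F-comm }
      ; *-cong = cong₂ _*F_
      ; *-assoc = *F-assoc
      ; *-identity = *F-identityˡ , *F-identityʳ
      ; distrib = *F-distribˡ , *F-distribʳ }
    ; *-comm = *F-comm }

  F-commutativeRing : CommutativeRing 0ℓ 0ℓ
  F-commutativeRing = record { isCommutativeRing = F-isCommutativeRing }

  ℚ⇒F : ℚ → F
  ℚ⇒F q = q +√D 0ℚ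

  ℚ⇒F-homomorphism : ℚ.+-*-rawRing -Raw-AlmostCommutative⟶ fromCommutativeRing F-commutativeRing
  ℚ⇒F-homomorphism = record
    { ⟦_⟧ = ℚ⇒F
    ; +-homo = λ p q → cong ((p + q) +√D_) (sym (ℚP.+-identityʳ 0ℚ))
    ; *-homo = λ p q → cong₂ _+√D_ (re-homo Dq p q) (ir-homo p q)
    ; -‿homo = λ _ → refl
    ; 0-homo = refl
    ; 1-homo = refl }
    where
    re-homo : ∀ d p q → p * q ≡ (p * q) + (d * (0ℚ * 0ℚ))
    re-homo = ℚSolver.solve-∀ ℚ-ring
    ir-homo : ∀ p q → 0ℚ ≡ (p * 0ℚ) + (0ℚ * q)
    ir-homo = ℚSolver.solve-∀ ℚ-ring

  ℚ⇒F-≟ : ∀ p q → Maybe (ℚ⇒F p ≡ ℚ⇒F q)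
  ℚ⇒F-≟ p q with p ℚ.≟ q
  ... | yes refl = just refl
  ... | no _     = nothing

  -- Rational coefficients, so that the constants ½ and 1/4 in e₃, e₄ and κ are normalised.
  open RingSolver ℚ.+-*-rawRing (fromCommutativeRing F-commutativeRing) ℚ⇒F-homomorphism ℚ⇒F-≟
    using (Polynomial; con; var; _:+_; _:*_; :-_; ⟦_⟧; ⟦_⟧↓; prove)

  open import Algebra.Definitions.RawSemiring (Semiring.rawSemiring (CommutativeRing.semiring F-commutativeRing))
    using () renaming (_^_ to _^F_)

  closeᴾ : ∀ {A : Set} n → N-ary n (Polynomial n) A → A
  closeᴾ n f = f $ⁿ Vec.map var (allFin n)

  F-solve : ∀ {n} (ρ : Vec F n) (f : N-ary n (Polynomial n) (Polynomial n × Polynomial n)) →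
            ⟦ proj₁ (closeᴾ n f) ⟧↓ ρ ≡ ⟦ proj₂ (closeᴾ n f) ⟧↓ ρ →
            ⟦ proj₁ (closeᴾ n f) ⟧ ρ ≡ ⟦ proj₂ (closeᴾ n f) ⟧ ρ
  F-solve {n} ρ f = prove ρ (proj₁ (closeᴾ n f)) (proj₂ (closeᴾ n f))

  -- The operations mirror those of B clause for clause,
  -- so ⟦_⟧ᴴ commutes with them definitionally and an identity in B, with √D and the coordinates
  -- of its arguments as variables, reduces to four polynomial identities checked by the solver.
  record ℍ (n : ℕ) : Set where
    constructor quatᴾ
    field
      c1ᴾ ciᴾ cjᴾ ckᴾ : Polynomial n
  open ℍ

  module _ {n : ℕ} where

    _+ᴾ_ : ℍ n → ℍ n → ℍ n
    quatᴾ a b c d +ᴾ quatᴾ a′ b′ c′ d′ = quatᴾ (a :+ a′) (b :+ b′) (c :+ c′) (d :+ d′)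

    -ᴾ_ : ℍ n → ℍ n
    -ᴾ quatᴾ a b c d = quatᴾ (:- a) (:- b) (:- c) (:- d)

    _*ᴾ_ : ℍ n → ℍ n → ℍ n
    quatᴾ a1 b1 c1 d1 *ᴾ quatᴾ a2 b2 c2 d2 = quatᴾ
      ((((a1 :* a2) :+ (:- (b1 :* b2))) :+ (:- (c1 :* c2))) :+ (:- (d1 :* d2)))
      ((((a1 :* b2) :+ (b1 :* a2)) :+ (c1 :* d2)) :+ (:- (d1 :* c2)))
      ((((a1 :* c2) :+ (:- (b1 :* d2))) :+ (c1 :* a2)) :+ (d1 :* b2))
      ((((a1 :* d2) :+ (b1 :* c2)) :+ (:- (c1 :* b2))) :+ (d1 :* a2))

    _·ᴾ_ : Polynomial n → ℍ n → ℍ n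
    s ·ᴾ quatᴾ a b c d = quatᴾ (s :* a) (s :* b) (s :* c) (s :* d)

    0ᴾ 1ᴾ 𝐢ᴾ 𝐣ᴾ 𝐤ᴾ : ℍ n
    0ᴾ = quatᴾ (con 0ℚ) (con 0ℚ) (con 0ℚ) (con 0ℚ)
    1ᴾ = quatᴾ (con 1ℚ) (con 0ℚ) (con 0ℚ) (con 0ℚ)
    𝐢ᴾ = quatᴾ (con 0ℚ) (con 1ℚ) (con 0ℚ) (con 0ℚ)
    𝐣ᴾ = quatᴾ (con 0ℚ) (con 0ℚ) (con 1ℚ) (con 0ℚ)
    𝐤ᴾ = quatᴾ (con 0ℚ) (con 0ℚ) (con 0ℚ) (con 1ℚ)

    e₃ᴾ e₄ᴾ : Polynomial n → ℍ n
    e₃ᴾ s = con ½ ·ᴾ ((s ·ᴾ 𝐢ᴾ) +ᴾ 𝐣ᴾ)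
    e₄ᴾ s = con ½ ·ᴾ ((s ·ᴾ 1ᴾ) +ᴾ 𝐤ᴾ)

    ⟦_⟧ᴴ ⟦_⟧↓ᴴ : ℍ n → Vec F n → B
    ⟦ quatᴾ a b c d ⟧ᴴ  ρ = quat (⟦ a ⟧ ρ) (⟦ b ⟧ ρ) (⟦ c ⟧ ρ) (⟦ d ⟧ ρ)
    ⟦ quatᴾ a b c d ⟧↓ᴴ ρ = quat (⟦ a ⟧↓ ρ) (⟦ b ⟧↓ ρ) (⟦ c ⟧↓ ρ) (⟦ d ⟧↓ ρ)

  ℍ-solve : ∀ {n} (ρ : Vec F n) (f : N-ary n (Polynomial n) (ℍ n × ℍ n)) →
            ⟦ proj₁ (closeᴾ n f) ⟧↓ᴴ ρ ≡ ⟦ proj₂ (closeᴾ n f) ⟧↓ᴴ ρ →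
            ⟦ proj₁ (closeᴾ n f) ⟧ᴴ ρ ≡ ⟦ proj₂ (closeᴾ n f) ⟧ᴴ ρ
  ℍ-solve {n} ρ f = prove-ℍ (proj₁ (closeᴾ n f)) (proj₂ (closeᴾ n f))
    where
    prove-ℍ : ∀ x y → ⟦ x ⟧↓ᴴ ρ ≡ ⟦ y ⟧↓ᴴ ρ → ⟦ x ⟧ᴴ ρ ≡ ⟦ y ⟧ᴴ ρ
    prove-ℍ (quatᴾ a b c d) (quatᴾ a′ b′ c′ d′) eq
      rewrite prove ρ a a′ (cong c1 eq) | prove ρ b b′ (cong ci eq)
            | prove ρ c c′ (cong cj eq) | prove ρ d d′ (cong ck eq) = refl

  Integral : F → Set
  Integral f = IsInteger (re f) × IsInteger (ir f)

  Integral-ι : ∀ z → Integral (ι z)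
  Integral-ι (a +√D' b) = (a , refl) , (b , refl)

  Integral-+ : ∀ {f g} → Integral f → Integral g → Integral (f +F g)
  Integral-+ (a , b) (c , d) = IsInteger-+ a c , IsInteger-+ b d

  Integral-neg : ∀ {f} → Integral f → Integral (-F f)
  Integral-neg (a , b) = IsInteger-neg a , IsInteger-neg b

  Integral-* : ∀ {f g} → Integral f → Integral g → Integral (f *F g)
  Integral-* (a , b) (c , d) =
    IsInteger-+ (IsInteger-* a c) (IsInteger-* (+ D , refl) (IsInteger-* b d)) ,
    IsInteger-+ (IsInteger-* a d) (IsInteger-* b c)

  Integral-0 : Integral 0F
  Integral-0 = Integral-ι ((+ 0) +√D' (+ 0))

  Integral-1 : Integral 1F
  Integral-1 = Integral-ι ((+ 1) +√D' (+ 0))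

  Integral-√D : Integral √D
  Integral-√D = Integral-ι ((+ 0) +√D' (+ 1))

  ⟪_,_,_,_⟫ : F → F → F → F → B
  ⟪ a , b , c , d ⟫ = (((a · 1B) +B (b · 𝐢)) +B (c · e₃)) +B (d · e₄)

  ⟪_,_,_,_⟫ᴾ_ : ∀ {n} → Polynomial n → Polynomial n → Polynomial n → Polynomial n → Polynomial n → ℍ n
  ⟪ a , b , c , d ⟫ᴾ s = (((a ·ᴾ 1ᴾ) +ᴾ (b ·ᴾ 𝐢ᴾ)) +ᴾ (c ·ᴾ e₃ᴾ s)) +ᴾ (d ·ᴾ e₄ᴾ s)

  κ δ : F
  κ = ((+ 1 / 4) +√D 0ℚ) *F ((√D *F √D) +F 1F)
  δ = (κ +F κ) +F (-F 1F)

  κᴾ δᴾ : ∀ {n} → Polynomial n → Polynomial n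
  κᴾ s = con (+ 1 / 4) :* ((s :* s) :+ con 1ℚ)
  δᴾ s = (κᴾ s :+ κᴾ s) :+ (:- con 1ℚ)

  trd nrd : B → F
  trd x = c1 x +F c1 x
  nrd x = (((c1 x *F c1 x) +F (ci x *F ci x)) +F (cj x *F cj x)) +F (ck x *F ck x)

  trdᴾ nrdᴾ : ∀ {n} → ℍ n → Polynomial n
  trdᴾ x = c1ᴾ x :+ c1ᴾ x
  nrdᴾ (quatᴾ a b c d) = (((a :* a) :+ (b :* b)) :+ (c :* c)) :+ (d :* d)

  -- 2 x̄, written with the ring operations and i, j, k only.
  twice-conj : B → B
  twice-conj x = -B ((x +B ((𝐢 *B x) *B 𝐢)) +B (((𝐣 *B x) *B 𝐣) +B ((𝐤 *B x) *B 𝐤)))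

  _^B_ : B → ℕ → B
  x ^B zero  = 1B
  x ^B suc m = x *B (x ^B m)

  basis : Vec B 4
  basis = 1B ∷ 𝐢 ∷ e₃ ∷ e₄ ∷ []

  coordinates : B → Vec F 4
  coordinates x = (c1 x +F (-F (√D *F ck x))) ∷ (ci x +F (-F (√D *F cj x))) ∷ (cj x +F cj x) ∷ (ck x +F ck x) ∷ []

  1B≡⟪⟫ : 1B ≡ ⟪ 1F , 0F , 0F , 0F ⟫
  1B≡⟪⟫ = ℍ-solve (√D ∷ []) (λ s → 1ᴾ , ⟪ con 1ℚ , con 0ℚ , con 0ℚ , con 0ℚ ⟫ᴾ s) refl

  𝐢≡⟪⟫ : 𝐢 ≡ ⟪ 0F , 1F , 0F , 0F ⟫
  𝐢≡⟪⟫ = ℍ-solve (√D ∷ []) (λ s → 𝐢ᴾ , ⟪ con 0ℚ , con 1ℚ , con 0ℚ , con 0ℚ ⟫ᴾ s) refl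

  𝐣≡⟪⟫ : 𝐣 ≡ ⟪ 0F , -F √D , 1F +F 1F , 0F ⟫
  𝐣≡⟪⟫ = ℍ-solve (√D ∷ []) (λ s → 𝐣ᴾ , ⟪ con 0ℚ , :- s , con 1ℚ :+ con 1ℚ , con 0ℚ ⟫ᴾ s) refl

  𝐤≡⟪⟫ : 𝐤 ≡ ⟪ -F √D , 0F , 0F , 1F +F 1F ⟫
  𝐤≡⟪⟫ = ℍ-solve (√D ∷ []) (λ s → 𝐤ᴾ , ⟪ :- s , con 0ℚ , con 0ℚ , con 1ℚ :+ con 1ℚ ⟫ᴾ s) refl

  e₃≡⟪⟫ : e₃ ≡ ⟪ 0F , 0F , 1F , 0F ⟫
  e₃≡⟪⟫ = ℍ-solve (√D ∷ []) (λ s → e₃ᴾ s , ⟪ con 0ℚ , con 0ℚ , con 1ℚ , con 0ℚ ⟫ᴾ s) refl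

  e₄≡⟪⟫ : e₄ ≡ ⟪ 0F , 0F , 0F , 1F ⟫
  e₄≡⟪⟫ = ℍ-solve (√D ∷ []) (λ s → e₄ᴾ s , ⟪ con 0ℚ , con 0ℚ , con 0ℚ , con 1ℚ ⟫ᴾ s) refl

  ⟪⟫-+B : ∀ a b c d a′ b′ c′ d′ →
          ⟪ a , b , c , d ⟫ +B ⟪ a′ , b′ , c′ , d′ ⟫ ≡ ⟪ a +F a′ , b +F b′ , c +F c′ , d +F d′ ⟫
  ⟪⟫-+B a b c d a′ b′ c′ d′ = ℍ-solve (√D ∷ a ∷ b ∷ c ∷ d ∷ a′ ∷ b′ ∷ c′ ∷ d′ ∷ [])
    (λ s a b c d a′ b′ c′ d′ → (⟪ a , b , c , d ⟫ᴾ s) +ᴾ (⟪ a′ , b′ , c′ , d′ ⟫ᴾ s) ,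
                               ⟪ a :+ a′ , b :+ b′ , c :+ c′ , d :+ d′ ⟫ᴾ s) refl

  ⟪⟫-neg : ∀ a b c d → -B ⟪ a , b , c , d ⟫ ≡ ⟪ -F a , -F b , -F c , -F d ⟫
  ⟪⟫-neg a b c d = ℍ-solve (√D ∷ a ∷ b ∷ c ∷ d ∷ [])
    (λ s a b c d → -ᴾ (⟪ a , b , c , d ⟫ᴾ s) , ⟪ :- a , :- b , :- c , :- d ⟫ᴾ s) refl

  ⟪⟫-· : ∀ r a b c d → r · ⟪ a , b , c , d ⟫ ≡ ⟪ r *F a , r *F b , r *F c , r *F d ⟫
  ⟪⟫-· r a b c d = ℍ-solve (√D ∷ r ∷ a ∷ b ∷ c ∷ d ∷ [])
    (λ s r a b c d → r ·ᴾ (⟪ a , b , c , d ⟫ᴾ s) , ⟪ r :* a , r :* b , r :* c , r :* d ⟫ᴾ s) refl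

  ⟪⟫-*B : ∀ a b c d y → ⟪ a , b , c , d ⟫ *B y ≡ (((a · y) +B (b · (𝐢 *B y))) +B (c · (e₃ *B y))) +B (d · (e₄ *B y))
  ⟪⟫-*B a b c d y = ℍ-solve (√D ∷ a ∷ b ∷ c ∷ d ∷ c1 y ∷ ci y ∷ cj y ∷ ck y ∷ [])
    (λ s a b c d y₁ yᵢ yⱼ yₖ → let y = quatᴾ y₁ yᵢ yⱼ yₖ in
       (⟪ a , b , c , d ⟫ᴾ s) *ᴾ y , (((a ·ᴾ y) +ᴾ (b ·ᴾ (𝐢ᴾ *ᴾ y))) +ᴾ (c ·ᴾ (e₃ᴾ s *ᴾ y))) +ᴾ (d ·ᴾ (e₄ᴾ s *ᴾ y))) refl

  𝐢-*B-⟪⟫ : ∀ a b c d → 𝐢 *B ⟪ a , b , c , d ⟫ ≡ ⟪ -F (b +F (√D *F c)) , a +F (√D *F d) , -F d , c ⟫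
  𝐢-*B-⟪⟫ a b c d = ℍ-solve (√D ∷ a ∷ b ∷ c ∷ d ∷ [])
    (λ s a b c d → 𝐢ᴾ *ᴾ (⟪ a , b , c , d ⟫ᴾ s) , ⟪ :- (b :+ (s :* c)) , a :+ (s :* d) , :- d , c ⟫ᴾ s) refl

  e₃-*B-⟪⟫ : ∀ a b c d → e₃ *B ⟪ a , b , c , d ⟫ ≡ ⟪ -F (κ *F c) , κ *F d , a , -F b ⟫
  e₃-*B-⟪⟫ a b c d = ℍ-solve (√D ∷ a ∷ b ∷ c ∷ d ∷ [])
    (λ s a b c d → e₃ᴾ s *ᴾ (⟪ a , b , c , d ⟫ᴾ s) , ⟪ :- (κᴾ s :* c) , κᴾ s :* d , a , :- b ⟫ᴾ s) refl

  e₄-*B-⟪⟫ : ∀ a b c d → e₄ *B ⟪ a , b , c , d ⟫ ≡ ⟪ -F (κ *F d) , -F (κ *F c) , b +F (√D *F c) , a +F (√D *F d) ⟫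
  e₄-*B-⟪⟫ a b c d = ℍ-solve (√D ∷ a ∷ b ∷ c ∷ d ∷ [])
    (λ s a b c d → e₄ᴾ s *ᴾ (⟪ a , b , c , d ⟫ᴾ s) , ⟪ :- (κᴾ s :* d) , :- (κᴾ s :* c) , b :+ (s :* c) , a :+ (s :* d) ⟫ᴾ s) refl

  ⟪⟫≡combF : ∀ a b c d → ⟪ a , b , c , d ⟫ ≡ combF (a ∷ b ∷ c ∷ d ∷ []) basis
  ⟪⟫≡combF a b c d = ℍ-solve (√D ∷ a ∷ b ∷ c ∷ d ∷ [])
    (λ s a b c d → ⟪ a , b , c , d ⟫ᴾ s , (a ·ᴾ 1ᴾ) +ᴾ ((b ·ᴾ 𝐢ᴾ) +ᴾ ((c ·ᴾ e₃ᴾ s) +ᴾ ((d ·ᴾ e₄ᴾ s) +ᴾ 0ᴾ)))) refl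

  ≡combF-coordinates : ∀ x → x ≡ combF (coordinates x) basis
  ≡combF-coordinates x = ℍ-solve (√D ∷ c1 x ∷ ci x ∷ cj x ∷ ck x ∷ [])
    (λ s x₁ xᵢ xⱼ xₖ → quatᴾ x₁ xᵢ xⱼ xₖ ,
       ((x₁ :+ (:- (s :* xₖ))) ·ᴾ 1ᴾ) +ᴾ (((xᵢ :+ (:- (s :* xⱼ))) ·ᴾ 𝐢ᴾ) +ᴾ (((xⱼ :+ xⱼ) ·ᴾ e₃ᴾ s) +ᴾ (((xₖ :+ xₖ) ·ᴾ e₄ᴾ s) +ᴾ 0ᴾ)))) refl

  trace-coordinates : ∀ x → x ≡ ⟪ (√D *F trd (x *B e₄)) +F (-F (δ *F trd x))
                                , ((δ *F trd (x *B 𝐢)) +F (√D *F trd (x *B 𝐣))) +F (-F (√D *F trd (x *B e₃)))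
                                , -F trd (x *B 𝐣)
                                , -F trd (x *B 𝐤) ⟫
  trace-coordinates x = ℍ-solve (√D ∷ c1 x ∷ ci x ∷ cj x ∷ ck x ∷ [])
    (λ s x₁ xᵢ xⱼ xₖ → let x = quatᴾ x₁ xᵢ xⱼ xₖ in
       x , ⟪ (s :* trdᴾ (x *ᴾ e₄ᴾ s)) :+ (:- (δᴾ s :* trdᴾ x))
           , ((δᴾ s :* trdᴾ (x *ᴾ 𝐢ᴾ)) :+ (s :* trdᴾ (x *ᴾ 𝐣ᴾ))) :+ (:- (s :* trdᴾ (x *ᴾ e₃ᴾ s)))
           , :- trdᴾ (x *ᴾ 𝐣ᴾ)
           , :- trdᴾ (x *ᴾ 𝐤ᴾ) ⟫ᴾ s) refl

  trd≡nrd-difference : ∀ x → trd x ≡ (nrd (x +B 1B) +F (-F (nrd x))) +F (-F 1F)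
  trd≡nrd-difference x = F-solve (c1 x ∷ ci x ∷ cj x ∷ ck x ∷ [])
    (λ x₁ xᵢ xⱼ xₖ → let x = quatᴾ x₁ xᵢ xⱼ xₖ in
       trdᴾ x , (nrdᴾ (x +ᴾ 1ᴾ) :+ (:- nrdᴾ x)) :+ (:- con 1ℚ)) refl

  nrd-*B : ∀ x y → nrd (x *B y) ≡ nrd x *F nrd y
  nrd-*B x y = F-solve (c1 x ∷ ci x ∷ cj x ∷ ck x ∷ c1 y ∷ ci y ∷ cj y ∷ ck y ∷ [])
    (λ x₁ xᵢ xⱼ xₖ y₁ yᵢ yⱼ yₖ → let x = quatᴾ x₁ xᵢ xⱼ xₖ ; y = quatᴾ y₁ yᵢ yⱼ yₖ in
       nrdᴾ (x *ᴾ y) , nrdᴾ x :* nrdᴾ y) refl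

  nrd-^B : ∀ x m → nrd (x ^B m) ≡ nrd x ^F m
  nrd-^B x zero    = F-solve [] (nrdᴾ 1ᴾ , con 1ℚ) refl
  nrd-^B x (suc m) = trans (nrd-*B x (x ^B m)) (cong (nrd x *F_) (nrd-^B x m))

  *B-twice-conj : ∀ x → x *B twice-conj x ≡ (nrd x +F nrd x) · 1B
  *B-twice-conj x = ℍ-solve (c1 x ∷ ci x ∷ cj x ∷ ck x ∷ [])
    (λ x₁ xᵢ xⱼ xₖ → let x = quatᴾ x₁ xᵢ xⱼ xₖ in
       x *ᴾ (-ᴾ ((x +ᴾ ((𝐢ᴾ *ᴾ x) *ᴾ 𝐢ᴾ)) +ᴾ (((𝐣ᴾ *ᴾ x) *ᴾ 𝐣ᴾ) +ᴾ ((𝐤ᴾ *ᴾ x) *ᴾ 𝐤ᴾ)))) ,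
       (nrdᴾ x :+ nrdᴾ x) ·ᴾ 1ᴾ) refl

  ⟪⟫∈𝒪 : ∀ {a b c d} → Integral a → Integral b → Integral c → Integral d → 𝒪 ⟪ a , b , c , d ⟫
  ⟪⟫∈𝒪 {_ +√D _} {_ +√D _} {_ +√D _} {_ +√D _}
    ((a₁ , refl) , (a₂ , refl)) ((b₁ , refl) , (b₂ , refl)) ((c₁ , refl) , (c₂ , refl)) ((d₁ , refl) , (d₂ , refl)) =
    a₁ +√D' a₂ , b₁ +√D' b₂ , c₁ +√D' c₂ , d₁ +√D' d₂ , refl

  𝒪-+ : ∀ x y → 𝒪 x → 𝒪 y → 𝒪 (x +B y)
  𝒪-+ _ _ (a , b , c , d , refl) (a′ , b′ , c′ , d′ , refl) =
    subst 𝒪 (sym (⟪⟫-+B (ι a) (ι b) (ι c) (ι d) (ι a′) (ι b′) (ι c′) (ι d′)))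
      (⟪⟫∈𝒪 (Integral-+ (Integral-ι a) (Integral-ι a′)) (Integral-+ (Integral-ι b) (Integral-ι b′))
            (Integral-+ (Integral-ι c) (Integral-ι c′)) (Integral-+ (Integral-ι d) (Integral-ι d′)))

  𝒪-neg : ∀ x → 𝒪 x → 𝒪 (-B x)
  𝒪-neg _ (a , b , c , d , refl) = subst 𝒪 (sym (⟪⟫-neg (ι a) (ι b) (ι c) (ι d)))
    (⟪⟫∈𝒪 (Integral-neg (Integral-ι a)) (Integral-neg (Integral-ι b))
          (Integral-neg (Integral-ι c)) (Integral-neg (Integral-ι d)))

  𝒪-· : ∀ {r} x → Integral r → 𝒪 x → 𝒪 (r · x)
  𝒪-· {r} _ r∈ (a , b , c , d , refl) = subst 𝒪 (sym (⟪⟫-· r (ι a) (ι b) (ι c) (ι d)))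
    (⟪⟫∈𝒪 (Integral-* r∈ (Integral-ι a)) (Integral-* r∈ (Integral-ι b))
          (Integral-* r∈ (Integral-ι c)) (Integral-* r∈ (Integral-ι d)))

  𝒪-𝐢* : ∀ y → 𝒪 y → 𝒪 (𝐢 *B y)
  𝒪-𝐢* _ (a , b , c , d , refl) = subst 𝒪 (sym (𝐢-*B-⟪⟫ (ι a) (ι b) (ι c) (ι d)))
    (⟪⟫∈𝒪 (Integral-neg (Integral-+ (Integral-ι b) (Integral-* Integral-√D (Integral-ι c))))
          (Integral-+ (Integral-ι a) (Integral-* Integral-√D (Integral-ι d)))
          (Integral-neg (Integral-ι d)) (Integral-ι c))

  1B∈𝒪 : 𝒪 1B
  1B∈𝒪 = subst 𝒪 (sym 1B≡⟪⟫) (⟪⟫∈𝒪 Integral-1 Integral-0 Integral-0 Integral-0)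

  𝐢∈𝒪 : 𝒪 𝐢
  𝐢∈𝒪 = subst 𝒪 (sym 𝐢≡⟪⟫) (⟪⟫∈𝒪 Integral-0 Integral-1 Integral-0 Integral-0)

  𝐣∈𝒪 : 𝒪 𝐣
  𝐣∈𝒪 = subst 𝒪 (sym 𝐣≡⟪⟫) (⟪⟫∈𝒪 Integral-0 (Integral-neg Integral-√D) (Integral-+ Integral-1 Integral-1) Integral-0)

  𝐤∈𝒪 : 𝒪 𝐤
  𝐤∈𝒪 = subst 𝒪 (sym 𝐤≡⟪⟫) (⟪⟫∈𝒪 (Integral-neg Integral-√D) Integral-0 Integral-0 (Integral-+ Integral-1 Integral-1))

  e₃∈𝒪 : 𝒪 e₃
  e₃∈𝒪 = subst 𝒪 (sym e₃≡⟪⟫) (⟪⟫∈𝒪 Integral-0 Integral-0 Integral-1 Integral-0)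

  e₄∈𝒪 : 𝒪 e₄
  e₄∈𝒪 = subst 𝒪 (sym e₄≡⟪⟫) (⟪⟫∈𝒪 Integral-0 Integral-0 Integral-0 Integral-1)

  basis⊆𝒪 : All 𝒪 basis
  basis⊆𝒪 = 1B∈𝒪 ∷ 𝐢∈𝒪 ∷ e₃∈𝒪 ∷ e₄∈𝒪 ∷ []

  -- Bounded denominators in F and B

  record _∙_∈ℤ[√D] (N : ℕ) (f : F) : Set where
    constructor _,_
    field
      re∈ : N ∙ re f ∈ℤ
      ir∈ : N ∙ ir f ∈ℤ

  record _∙_∈ℤ[√D]⁴ (N : ℕ) (x : B) : Set where
    constructor ⟨_,_,_,_⟩
    field
      c1∈ : N ∙ c1 x ∈ℤ[√D]
      ci∈ : N ∙ ci x ∈ℤ[√D]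
      cj∈ : N ∙ cj x ∈ℤ[√D]
      ck∈ : N ∙ ck x ∈ℤ[√D]

  infix 4 _∙_∈ℤ[√D] _∙_∈ℤ[√D]⁴

  ∈ℤ[√D]-+ : ∀ {N f g} → N ∙ f ∈ℤ[√D] → N ∙ g ∈ℤ[√D] → N ∙ f +F g ∈ℤ[√D]
  ∈ℤ[√D]-+ (a , b) (c , d) = ∈ℤ-+ a c , ∈ℤ-+ b d

  ∈ℤ[√D]-* : ∀ {N r f} → Integral r → N ∙ f ∈ℤ[√D] → N ∙ r *F f ∈ℤ[√D]
  ∈ℤ[√D]-* (a , b) (c , d) = ∈ℤ-+ (∈ℤ-* a c) (∈ℤ-* (+ D , refl) (∈ℤ-* b d)) , ∈ℤ-+ (∈ℤ-* a d) (∈ℤ-* b c)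

  ∈ℤ[√D]-*ˡ : ∀ M {N f} → N ∙ f ∈ℤ[√D] → M ℕ.* N ∙ f ∈ℤ[√D]
  ∈ℤ[√D]-*ˡ M (a , b) = ∈ℤ-*ˡ M a , ∈ℤ-*ˡ M b

  ∈ℤ[√D]-double : ∀ {N f} → N ∙ f +F f ∈ℤ[√D] → 2 ℕ.* N ∙ f ∈ℤ[√D]
  ∈ℤ[√D]-double (a , b) = ∈ℤ-double a , ∈ℤ-double b

  ∈ℤ[√D]⁴-+ : ∀ {N x y} → N ∙ x ∈ℤ[√D]⁴ → N ∙ y ∈ℤ[√D]⁴ → N ∙ x +B y ∈ℤ[√D]⁴
  ∈ℤ[√D]⁴-+ ⟨ a , b , c , d ⟩ ⟨ a′ , b′ , c′ , d′ ⟩ = ⟨ ∈ℤ[√D]-+ a a′ , ∈ℤ[√D]-+ b b′ , ∈ℤ[√D]-+ c c′ , ∈ℤ[√D]-+ d d′ ⟩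

  ∈ℤ[√D]⁴-· : ∀ {N r x} → Integral r → N ∙ x ∈ℤ[√D]⁴ → N ∙ r · x ∈ℤ[√D]⁴
  ∈ℤ[√D]⁴-· r∈ ⟨ a , b , c , d ⟩ = ⟨ ∈ℤ[√D]-* r∈ a , ∈ℤ[√D]-* r∈ b , ∈ℤ[√D]-* r∈ c , ∈ℤ[√D]-* r∈ d ⟩

  ∈ℤ[√D]⁴-*ˡ : ∀ M {N x} → N ∙ x ∈ℤ[√D]⁴ → M ℕ.* N ∙ x ∈ℤ[√D]⁴
  ∈ℤ[√D]⁴-*ˡ M ⟨ a , b , c , d ⟩ = ⟨ ∈ℤ[√D]-*ˡ M a , ∈ℤ[√D]-*ˡ M b , ∈ℤ[√D]-*ˡ M c , ∈ℤ[√D]-*ˡ M d ⟩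

  ∈ℤ[√D]⁴-combZ : ∀ {N n} (cs : Vec ZF n) gs → All (N ∙_∈ℤ[√D]⁴) gs → N ∙ combZ cs gs ∈ℤ[√D]⁴
  ∈ℤ[√D]⁴-combZ []       []       []         = ⟨ (∈ℤ-0 , ∈ℤ-0) , (∈ℤ-0 , ∈ℤ-0) , (∈ℤ-0 , ∈ℤ-0) , (∈ℤ-0 , ∈ℤ-0) ⟩
  ∈ℤ[√D]⁴-combZ (c ∷ cs) (g ∷ gs) (g∈ ∷ gs∈) = ∈ℤ[√D]⁴-+ (∈ℤ[√D]⁴-· (Integral-ι c) g∈) (∈ℤ[√D]⁴-combZ cs gs gs∈)

  F-bound : ∀ f → HasBound _∙_∈ℤ[√D] f
  F-bound f = repack (common-bound _∙_∈ℤ ∈ℤ-*ˡ (λ r → ↧ₙ r , s≤s z≤n , ∈ℤ-denominator r) (re f ∷ ir f ∷ []))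
    where
    repack : HasBound (λ N → All (N ∙_∈ℤ)) (re f ∷ ir f ∷ []) → HasBound _∙_∈ℤ[√D] f
    repack (N , 0<N , a ∷ b ∷ []) = N , 0<N , (a , b)

  B-bound : ∀ x → HasBound _∙_∈ℤ[√D]⁴ x
  B-bound x = repack (common-bound _∙_∈ℤ[√D] ∈ℤ[√D]-*ˡ F-bound (c1 x ∷ ci x ∷ cj x ∷ ck x ∷ []))
    where
    repack : HasBound (λ N → All (N ∙_∈ℤ[√D])) (c1 x ∷ ci x ∷ cj x ∷ ck x ∷ []) → HasBound _∙_∈ℤ[√D]⁴ x
    repack (N , 0<N , a ∷ b ∷ c ∷ d ∷ []) = N , 0<N , ⟨ a , b , c , d ⟩

  bounded-denominators : ∀ {O} → IsOrder O → Σ ℕ λ N → 0 < N × (∀ x → O x → N ∙ x ∈ℤ[√D]⁴)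
  bounded-denominators {O} O-order = bound-spanned (IsOrder.finGen O-order)
    where
    bound-spanned : (Σ ℕ λ n → Σ (Vec B n) λ gs → All O gs × (∀ x → O x → Σ (Vec ZF n) λ cs → x ≡ combZ cs gs)) →
                    Σ ℕ λ N → 0 < N × (∀ x → O x → N ∙ x ∈ℤ[√D]⁴)
    bound-spanned (n , gs , _ , spanned) = bound-O (common-bound _∙_∈ℤ[√D]⁴ ∈ℤ[√D]⁴-*ˡ B-bound gs)
      where
      bound-O : HasBound (λ N → All (N ∙_∈ℤ[√D]⁴)) gs → Σ ℕ λ N → 0 < N × (∀ x → O x → N ∙ x ∈ℤ[√D]⁴)
      bound-O (N , 0<N , gs∈) = N , 0<N , λ x x∈O →
        subst (N ∙_∈ℤ[√D]⁴) (sym (proj₂ (spanned x x∈O))) (∈ℤ[√D]⁴-combZ (proj₁ (spanned x x∈O)) gs gs∈)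

  norm : F → ℚ
  norm x = re x * re x - Dq * (ir x * ir x)

  norm-*F : ∀ x y → norm (x *F y) ≡ norm x * norm y
  norm-*F (a +√D b) (c +√D e) = multiplicative Dq a b c e
    where
    multiplicative : ∀ d a b c e →
      (a * c + d * (b * e)) * (a * c + d * (b * e)) - d * ((a * e + b * c) * (a * e + b * c))
        ≡ (a * a - d * (b * b)) * (c * c - d * (e * e))
    multiplicative = ℚSolver.solve-∀ ℚ-ring

  norm-^F : ∀ x m → norm (x ^F m) ≡ norm x ^ℚ m
  norm-^F x zero    = norm-1F Dq
    where
    norm-1F : ∀ d → 1ℚ * 1ℚ - d * (0ℚ * 0ℚ) ≡ 1ℚ
    norm-1F = ℚSolver.solve-∀ ℚ-ring
  norm-^F x (suc m) = trans (norm-*F x (x ^F m)) (cong (norm x *_) (norm-^F x m))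

  ∈ℤ-norm : ∀ {N g} → N ∙ g ∈ℤ[√D] → N ℕ.* N ∙ norm g ∈ℤ
  ∈ℤ-norm {N} {g} (scaled Nre∈ℤ , scaled Nir∈ℤ) = scaled $ subst IsInteger
    (trans (scale-norm (ℤ→ℚ (+ N)) Dq (re g) (ir g)) (cong (_* norm g) (sym (ℤ→ℚ-pos-* N N))))
    (IsInteger-- (IsInteger-* Nre∈ℤ Nre∈ℤ) (IsInteger-* (+ D , refl) (IsInteger-* Nir∈ℤ Nir∈ℤ)))
    where
    scale-norm : ∀ n d a b → (n * a) * (n * a) - d * ((n * b) * (n * b)) ≡ (n * n) * (a * a - d * (b * b))
    scale-norm = ℚSolver.solve-∀ ℚ-ring

  bounded-powers⇒norm-IsInteger : ∀ N → 0 < N → ∀ h → (∀ m → N ∙ h ^F m ∈ℤ[√D]) → IsInteger (norm h)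
  bounded-powers⇒norm-IsInteger N 0<N h bounded = bounded-powers⇒IsInteger (N ℕ.* N) (ℕP.*-mono-< 0<N 0<N) (norm h)
    (λ m → subst (λ r → IsInteger (ℤ→ℚ (+ (N ℕ.* N)) * r)) (norm-^F h m) (_∙_∈ℤ.integer (∈ℤ-norm (bounded m))))

  successor-bounded-powers : ∀ {N} h → (∀ m → N ∙ h ^F m ∈ℤ[√D]) → ∀ m → N ∙ (h +F 1F) ^F m ∈ℤ[√D]
  successor-bounded-powers {N} h bounded m = subst (N ∙_∈ℤ[√D]) (*F-identityʳ _) (binomial m 0)
    where
    expand : ∀ X Y → ((h +F 1F) *F X) *F Y ≡ (X *F (h *F Y)) +F (X *F Y)
    expand X Y = F-solve (h ∷ X ∷ Y ∷ []) (λ h X Y → ((h :+ con 1ℚ) :* X) :* Y , (X :* (h :* Y)) :+ (X :* Y)) refl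
    binomial : ∀ m j → N ∙ ((h +F 1F) ^F m) *F (h ^F j) ∈ℤ[√D]
    binomial zero    j = subst (N ∙_∈ℤ[√D]) (sym (*F-identityˡ _)) (bounded j)
    binomial (suc m) j = subst (N ∙_∈ℤ[√D]) (sym (expand _ _)) (∈ℤ[√D]-+ (binomial m (suc j)) (binomial m j))

  module _ (k : ℕ) (D≡3+k*4 : D ≡ 3 ℕ.+ k ℕ.* 4) where

    -- 𝒪 is an order

    +D≡3+k*4 : + D ≡ + 3 ℤ.+ + k ℤ.* + 4
    +D≡3+k*4 = trans (cong +_ D≡3+k*4) (trans (ℤP.pos-+ 3 (k ℕ.* 4)) (cong (λ x → + 3 ℤ.+ x) (ℤP.pos-* k 4)))

    κ-Integral : Integral κ
    κ-Integral = subst Integral (sym κ≡k+1) (IsInteger-+ (+ k , refl) (+ 1 , refl) , (+ 0 , refl))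
      where
      open _-Raw-AlmostCommutative⟶_ ℚ⇒F-homomorphism
      √D*√D≡D : √D *F √D ≡ ℚ⇒F Dq
      √D*√D≡D = cong (_+√D 0ℚ) (trans (ℚP.+-identityˡ (Dq * 1ℚ)) (ℚP.*-identityʳ Dq))
      ¼[3+k*4+1]≡k+1 : ∀ k → (+ 1 / 4) * ((ℤ→ℚ (+ 3) + k * ℤ→ℚ (+ 4)) + 1ℚ) ≡ k + 1ℚ
      ¼[3+k*4+1]≡k+1 = ℚSolver.solve-∀ ℚ-ring
      κ≡k+1 : κ ≡ ℚ⇒F (ℤ→ℚ (+ k) + 1ℚ)
      κ≡k+1 = begin
        κ                                                   ≡⟨ cong (λ x → ℚ⇒F (+ 1 / 4) *F (x +F 1F)) √D*√D≡D ⟩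
        ℚ⇒F (+ 1 / 4) *F (ℚ⇒F Dq +F ℚ⇒F 1ℚ)                ≡⟨ cong (ℚ⇒F (+ 1 / 4) *F_) (+-homo Dq 1ℚ) ⟨
        ℚ⇒F (+ 1 / 4) *F ℚ⇒F (Dq + 1ℚ)                      ≡⟨ *-homo (+ 1 / 4) (Dq + 1ℚ) ⟨
        ℚ⇒F ((+ 1 / 4) * (Dq + 1ℚ))                          ≡⟨ cong (λ d → ℚ⇒F ((+ 1 / 4) * (d + 1ℚ))) Dq≡3+k*4 ⟩
        ℚ⇒F ((+ 1 / 4) * ((ℤ→ℚ (+ 3) + ℤ→ℚ (+ k) * ℤ→ℚ (+ 4)) + 1ℚ)) ≡⟨ cong ℚ⇒F (¼[3+k*4+1]≡k+1 (ℤ→ℚ (+ k))) ⟩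
        ℚ⇒F (ℤ→ℚ (+ k) + 1ℚ)                                ∎
        where
        open ≡-Reasoning
        Dq≡3+k*4 : Dq ≡ ℤ→ℚ (+ 3) + ℤ→ℚ (+ k) * ℤ→ℚ (+ 4)
        Dq≡3+k*4 = trans (cong ℤ→ℚ +D≡3+k*4)
          (trans (ℤ→ℚ-+ (+ 3) (+ k ℤ.* + 4)) (cong (λ x → ℤ→ℚ (+ 3) + x) (ℤ→ℚ-* (+ k) (+ 4))))

    δ-Integral : Integral δ
    δ-Integral = Integral-+ (Integral-+ κ-Integral κ-Integral) (Integral-neg Integral-1)

    𝒪-e₃* : ∀ y → 𝒪 y → 𝒪 (e₃ *B y)
    𝒪-e₃* _ (a , b , c , d , refl) = subst 𝒪 (sym (e₃-*B-⟪⟫ (ι a) (ι b) (ι c) (ι d)))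
      (⟪⟫∈𝒪 (Integral-neg (Integral-* κ-Integral (Integral-ι c))) (Integral-* κ-Integral (Integral-ι d))
            (Integral-ι a) (Integral-neg (Integral-ι b)))

    𝒪-e₄* : ∀ y → 𝒪 y → 𝒪 (e₄ *B y)
    𝒪-e₄* _ (a , b , c , d , refl) = subst 𝒪 (sym (e₄-*B-⟪⟫ (ι a) (ι b) (ι c) (ι d)))
      (⟪⟫∈𝒪 (Integral-neg (Integral-* κ-Integral (Integral-ι d))) (Integral-neg (Integral-* κ-Integral (Integral-ι c)))
            (Integral-+ (Integral-ι b) (Integral-* Integral-√D (Integral-ι c)))
            (Integral-+ (Integral-ι a) (Integral-* Integral-√D (Integral-ι d))))

    𝒪-* : ∀ x y → 𝒪 x → 𝒪 y → 𝒪 (x *B y)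
    𝒪-* _ y (a , b , c , d , refl) y∈𝒪 = subst 𝒪 (sym (⟪⟫-*B (ι a) (ι b) (ι c) (ι d) y))
      (𝒪-+ _ _ (𝒪-+ _ _ (𝒪-+ _ _ (𝒪-· y (Integral-ι a) y∈𝒪)
                                  (𝒪-· (𝐢 *B y) (Integral-ι b) (𝒪-𝐢* y y∈𝒪)))
                       (𝒪-· (e₃ *B y) (Integral-ι c) (𝒪-e₃* y y∈𝒪)))
               (𝒪-· (e₄ *B y) (Integral-ι d) (𝒪-e₄* y y∈𝒪)))

    𝒪-isOrder : IsOrder 𝒪
    𝒪-isOrder = record
      { one∈       = 1B∈𝒪
      ; +-closed   = 𝒪-+
      ; neg-closed = 𝒪-neg
      ; *-closed   = 𝒪-*
      ; ZF-closed  = λ r x → 𝒪-· x (Integral-ι r)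
      ; finGen     = 4 , basis , basis⊆𝒪 ,
                     λ { _ (a , b , c , d , refl) → (a ∷ b ∷ c ∷ d ∷ []) , ⟪⟫≡combF (ι a) (ι b) (ι c) (ι d) }
      ; spans      = λ y → 4 , coordinates y , basis , basis⊆𝒪 , ≡combF-coordinates y
      }

    halves-Integral : ∀ {h} → IsInteger (re h + re h) → IsInteger (ir h + ir h) → IsInteger (norm h) → Integral h
    halves-Integral {h} (X , X≡) (Y , Y≡) (n , n≡) =
      halve (X²-DY²≡0[mod4]⇒even k X Y n (subst (λ e → X ℤ.* X ℤ.- e ℤ.* (Y ℤ.* Y) ≡ + 4 ℤ.* n) +D≡3+k*4 X²-DY²≡4n))
      where
      expand : ∀ d r s → (r + r) * (r + r) - d * ((s + s) * (s + s)) ≡ ℤ→ℚ (+ 4) * (r * r - d * (s * s))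
      expand = ℚSolver.solve-∀ ℚ-ring
      X²-DY²≡4n : X ℤ.* X ℤ.- + D ℤ.* (Y ℤ.* Y) ≡ + 4 ℤ.* n
      X²-DY²≡4n = ℤ→ℚ-injective (begin
        ℤ→ℚ (X ℤ.* X ℤ.- + D ℤ.* (Y ℤ.* Y))              ≡⟨ ℤ→ℚ-+ (X ℤ.* X) (ℤ.- (+ D ℤ.* (Y ℤ.* Y))) ⟩
        ℤ→ℚ (X ℤ.* X) + ℤ→ℚ (ℤ.- (+ D ℤ.* (Y ℤ.* Y)))   ≡⟨ cong₂ _+_ (ℤ→ℚ-* X X) (ℤ→ℚ-neg (+ D ℤ.* (Y ℤ.* Y))) ⟩
        ℤ→ℚ X * ℤ→ℚ X - ℤ→ℚ (+ D ℤ.* (Y ℤ.* Y))         ≡⟨ cong (λ v → ℤ→ℚ X * ℤ→ℚ X - v) (trans (ℤ→ℚ-* (+ D) (Y ℤ.* Y)) (cong (Dq *_) (ℤ→ℚ-* Y Y))) ⟩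
        ℤ→ℚ X * ℤ→ℚ X - Dq * (ℤ→ℚ Y * ℤ→ℚ Y)            ≡⟨ cong₂ (λ x y → x * x - Dq * (y * y)) X≡ Y≡ ⟩
        (re h + re h) * (re h + re h) - Dq * ((ir h + ir h) * (ir h + ir h)) ≡⟨ expand Dq (re h) (ir h) ⟩
        ℤ→ℚ (+ 4) * norm h                               ≡⟨ cong (ℤ→ℚ (+ 4) *_) n≡ ⟨
        ℤ→ℚ (+ 4) * ℤ→ℚ n                                ≡⟨ ℤ→ℚ-* (+ 4) n ⟨
        ℤ→ℚ (+ 4 ℤ.* n)                                  ∎)
        where open ≡-Reasoning
      halve : (Σ ℤ λ X′ → Σ ℤ λ Y′ → X ≡ X′ ℤ.* + 2 × Y ≡ Y′ ℤ.* + 2) → Integral h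
      halve (X′ , Y′ , X≡2X′ , Y≡2Y′) =
        IsInteger-half X′ (trans (cong ℤ→ℚ (sym X≡2X′)) X≡) , IsInteger-half Y′ (trans (cong ℤ→ℚ (sym Y≡2Y′)) Y≡)

    module _ (sf : SquareFree D) where

      -- Maximality

      bounded-powers⇒Integral : ∀ N → 0 < N → ∀ h → (∀ m → N ∙ h ^F m ∈ℤ[√D]) → Integral h
      bounded-powers⇒Integral N 0<N h bounded = halves-Integral 2re∈ℤ 2ir∈ℤ norm∈ℤ
        where
        norm∈ℤ : IsInteger (norm h)
        norm∈ℤ = bounded-powers⇒norm-IsInteger N 0<N h bounded
        trace : ∀ d a b → ((a + 1ℚ) * (a + 1ℚ) - d * ((b + 0ℚ) * (b + 0ℚ)) - (a * a - d * (b * b))) - 1ℚ ≡ a + a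
        trace = ℚSolver.solve-∀ ℚ-ring
        2re∈ℤ : IsInteger (re h + re h)
        2re∈ℤ = subst IsInteger (trace Dq (re h) (ir h))
          (IsInteger-- (IsInteger-- (bounded-powers⇒norm-IsInteger N 0<N (h +F 1F) (successor-bounded-powers h bounded)) norm∈ℤ)
                       (+ 1 , refl))
        discriminant : ∀ d a b → (a + a) * (a + a) - ℤ→ℚ (+ 4) * (a * a - d * (b * b)) ≡ d * ((b + b) * (b + b))
        discriminant = ℚSolver.solve-∀ ℚ-ring
        2ir∈ℤ : IsInteger (ir h + ir h)
        2ir∈ℤ = squarefree⇒IsInteger D sf (ir h + ir h) (subst IsInteger (discriminant Dq (re h) (ir h))
          (IsInteger-- (IsInteger-* 2re∈ℤ 2re∈ℤ) (IsInteger-* (+ 4 , refl) norm∈ℤ)))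

      module _ {O : Subset} (O-order : IsOrder O) (𝒪⊆O : 𝒪 ⊆ O) where
        open IsOrder O-order

        ^B-closed : ∀ x m → O x → O (x ^B m)
        ^B-closed x zero    _   = one∈
        ^B-closed x (suc m) x∈O = *-closed _ _ x∈O (^B-closed x m x∈O)

        twice-conj-closed : ∀ x → O x → O (twice-conj x)
        twice-conj-closed x x∈O =
          neg-closed _ (+-closed _ _ (+-closed _ _ x∈O (sandwich 𝐢∈𝒪)) (+-closed _ _ (sandwich 𝐣∈𝒪) (sandwich 𝐤∈𝒪)))
          where
          sandwich : ∀ {u} → 𝒪 u → O ((u *B x) *B u)
          sandwich u∈𝒪 = *-closed _ _ (*-closed _ _ (𝒪⊆O _ u∈𝒪) x∈O) (𝒪⊆O _ u∈𝒪)

        nrd-Integral : ∀ y → O y → Integral (nrd y)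
        nrd-Integral y y∈O = integral (bounded-denominators O-order)
          where
          twice-nrdᵐ∈O : ∀ m → O (((nrd y ^F m) +F (nrd y ^F m)) · 1B)
          twice-nrdᵐ∈O m = subst O (trans (*B-twice-conj (y ^B m)) (cong (λ n → (n +F n) · 1B) (nrd-^B y m)))
            (*-closed _ _ (^B-closed y m y∈O) (twice-conj-closed _ (^B-closed y m y∈O)))
          integral : (Σ ℕ λ N → 0 < N × (∀ x → O x → N ∙ x ∈ℤ[√D]⁴)) → Integral (nrd y)
          integral (N , 0<N , bounded) = bounded-powers⇒Integral (2 ℕ.* N) (ℕP.*-mono-< {0} {2} (s≤s z≤n) 0<N) (nrd y)
            (λ m → ∈ℤ[√D]-double (subst (N ∙_∈ℤ[√D]) (*F-identityʳ _) (_∙_∈ℤ[√D]⁴.c1∈ (bounded _ (twice-nrdᵐ∈O m)))))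

        trd-Integral : ∀ y → O y → Integral (trd y)
        trd-Integral y y∈O = subst Integral (sym (trd≡nrd-difference y))
          (Integral-+ (Integral-+ (nrd-Integral _ (+-closed _ _ y∈O one∈)) (Integral-neg (nrd-Integral y y∈O)))
                      (Integral-neg Integral-1))

        O⊆𝒪 : O ⊆ 𝒪
        O⊆𝒪 x x∈O = subst 𝒪 (sym (trace-coordinates x)) (⟪⟫∈𝒪
            (Integral-+ (Integral-* Integral-√D (trd-x* e₄∈𝒪)) (Integral-neg (Integral-* δ-Integral (trd-Integral x x∈O))))
            (Integral-+ (Integral-+ (Integral-* δ-Integral (trd-x* 𝐢∈𝒪)) (Integral-* Integral-√D (trd-x* 𝐣∈𝒪)))
                        (Integral-neg (Integral-* Integral-√D (trd-x* e₃∈𝒪))))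
            (Integral-neg (trd-x* 𝐣∈𝒪))
            (Integral-neg (trd-x* 𝐤∈𝒪)))
          where
          trd-x* : ∀ {u} → 𝒪 u → Integral (trd (x *B u))
          trd-x* u∈𝒪 = trd-Integral _ (*-closed _ _ x∈O (𝒪⊆O _ u∈𝒪))

      𝒪-isMaximalOrder : IsMaximalOrder 𝒪
      𝒪-isMaximalOrder = record { isOrder = 𝒪-isOrder ; maximal = λ O O-order 𝒪⊆O → O⊆𝒪 O-order 𝒪⊆O }

lemma1 : ∀ (D : ℕ) → 0 < D → SquareFree D → D % 4 ≡ 3 →
           Quat.IsMaximalOrder D (Quat.𝒪 D)
-- The hypothesis 0 < D is implied by D % 4 ≡ 3.
lemma1 D _ sf D%4≡3 = 𝒪-isMaximalOrder D (D ℕ./ 4) D≡3+k*4 sf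
  where
  D≡3+k*4 : D ≡ 3 ℕ.+ (D ℕ./ 4) ℕ.* 4
  D≡3+k*4 = trans (ℕDivMod.m≡m%n+[m/n]*n D 4) (cong (ℕ._+ (D ℕ./ 4) ℕ.* 4) D%4≡3)
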